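{- Let $G$ be a pseudo strongly regular graph with parameters $(n,k,\mu)$. Then: (1) $L(G)$ is pseudo strongly regular with parameter $\mu=4$ if and only if $G\cong K_n$ with $n\ge 4$; (2) $L(G)$ is pseudo strongly regular with parameter $\mu=2$ if and only if $G$ is diamond-free and $K_4$-free and any two non-adjacent edges of $G$ belong to a $C_4$ in $G$; (3) $L(G)$ is pseudo strongly regular with parameter $\mu=1$ if and only if $G$ is diamond-free, $K_4$-free and $C_4$-free and any two non-adjacent edges of $G$ belong to a $P_4$ in $G$.
   Context: All graphs are finite and simple. A graph on $n$ vertices is pseudo strongly regular with parameters $(n,k,\mu)$ if every vertex has exactly $k$ neighbours and any two distinct non-adjacent vertices have exactly $\mu$ common neighbours. The line graph $L(G)$ has the edges of $G$ as vertices, two distinct edges being adjacent in $L(G)$ when they share an endpoint in $G$; two edges are non-adjacent if they share no endpoint. The diamond is $K_4$ minus one edge; $C_4$ is the 4-cycle and $P_4$ the path on 4 vertices. "$F$-free" means containing no subgraph isomorphic to $F$. -}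

module Defs where

open import Data.Nat using (ℕ; zero; suc; _<ᵇ_)
open import Data.Bool using (Bool; true; false; _∧_; _∨_; not; if_then_else_)
open import Data.Fin using (Fin; toℕ; _≟_)
open import Data.List using (List; []; _∷_; allFin; cartesianProduct)
open import Data.List.Membership.Propositional using (_∈_)
open import Data.Product using (_×_; _,_; Σ; ∃)
open import Relation.Binary.PropositionalEquality using (_≡_; _≢_; refl) renaming (sym to ≡-sym)
open import Relation.Nullary using (yes; no)
open import Data.Empty using (⊥; ⊥-elim)
open import Data.Fin using (zero; suc)
open import Relation.Nullary.Decidable using (⌊_⌋)
open import Function.Bundles using (_↔_; Inverse)

countB : {A : Set} → (A → Bool) → List A → ℕ
countB p [] = 0
countB p (x ∷ xs) = if p x then suc (countB p xs) else countB p xs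

-- Pseudo strong regularity of a graph whose vertex set is given by a
-- duplicate-free list `vs` and whose adjacency is the boolean relation `a`:
-- every vertex has exactly k neighbours, and any two distinct non-adjacent
-- vertices have exactly μ common neighbours.  (The parameter n is the
-- number of vertices, length vs.)
IsPSROn : {V : Set} → List V → (V → V → Bool) → ℕ → ℕ → Set
IsPSROn vs a k μ =
  (∀ v → v ∈ vs → countB (λ w → a v w) vs ≡ k)
  × (∀ v w → v ∈ vs → w ∈ vs → v ≢ w → a v w ≡ false →
       countB (λ u → a v u ∧ a w u) vs ≡ μ)

record Graph (n : ℕ) : Set where
  field
    adj    : Fin n → Fin n → Bool
    sym    : ∀ i j → adj i j ≡ adj j i
    irrefl : ∀ i → adj i i ≡ false
open Graph public

Adj : {n : ℕ} → Graph n → Fin n → Fin n → Set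
Adj G i j = adj G i j ≡ true

IsPSR : {n : ℕ} → Graph n → ℕ → ℕ → Set
IsPSR {n} G k μ = IsPSROn (allFin n) (adj G) k μ

_≅_ : {n : ℕ} → Graph n → Graph n → Set
_≅_ {n} G H = Σ (Fin n ↔ Fin n) λ f →
  ∀ i j → adj G i j ≡ adj H (Inverse.to f i) (Inverse.to f j)

eqᵇ : {n : ℕ} → Fin n → Fin n → Bool
eqᵇ i j = ⌊ i ≟ j ⌋

K : (n : ℕ) → Graph n
K n = record { adj = λ i j → not (eqᵇ i j) ; sym = symK ; irrefl = irrK }
  where
  symK : ∀ i j → not (eqᵇ i j) ≡ not (eqᵇ j i)
  symK i j with i ≟ j | j ≟ i
  ... | yes _ | yes _ = refl
  ... | no _  | no _  = refl
  ... | yes p | no q  = ⊥-elim (q (≡-sym p))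
  ... | no p  | yes q = ⊥-elim (p (≡-sym q))
  irrK : ∀ i → not (eqᵇ i i) ≡ false
  irrK i with i ≟ i
  ... | yes _ = refl
  ... | no p  = ⊥-elim (p refl)

-- Line graph.  An edge {a,b} of G is represented by the pair (a , b)
-- with toℕ a < toℕ b; the vertex list of L(G) is the list of all edges.

Edge : ℕ → Set
Edge n = Fin n × Fin n

edgeList : {n : ℕ} → Graph n → List (Edge n)
edgeList {n} G = Data.List.filterᵇ (λ { (a , b) → (toℕ a <ᵇ toℕ b) ∧ adj G a b })
                   (cartesianProduct (allFin n) (allFin n))
  where import Data.List

lineAdj : {n : ℕ} → Edge n → Edge n → Bool
lineAdj (a , b) (c , d) =
  not (eqᵇ a c ∧ eqᵇ b d) ∧ (eqᵇ a c ∨ eqᵇ a d ∨ eqᵇ b c ∨ eqᵇ b d)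

LinePSR : {n : ℕ} → Graph n → ℕ → Set
LinePSR G μ = ∃ λ k → IsPSROn (edgeList G) lineAdj k μ

LineNonComplete : {n : ℕ} → Graph n → Set
LineNonComplete G = Σ (Edge _) λ e → Σ (Edge _) λ f →
  e ∈ edgeList G × f ∈ edgeList G × e ≢ f × lineAdj e f ≡ false

Embedding : {m n : ℕ} → Graph m → Graph n → Set
Embedding {m} {n} F G = Σ (Fin m → Fin n) λ g →
  (∀ i j → g i ≡ g j → i ≡ j) × (∀ i j → Adj F i j → Adj G (g i) (g j))

Contains : {m n : ℕ} → Graph m → Graph n → Set
Contains F G = Embedding F G

Free : {m n : ℕ} → Graph m → Graph n → Set
Free F G = Contains F G → ⊥

diamondAdj : Fin 4 → Fin 4 → Bool
diamondAdj i j = not (eqᵇ i j) ∧ not ((eqᵇ i (suc (suc zero)) ∧ eqᵇ j (suc (suc (suc zero))))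
                                     ∨ (eqᵇ i (suc (suc (suc zero))) ∧ eqᵇ j (suc (suc zero))))

c4Adj : Fin 4 → Fin 4 → Bool
c4Adj zero (suc zero) = true
c4Adj (suc zero) zero = true
c4Adj (suc zero) (suc (suc zero)) = true
c4Adj (suc (suc zero)) (suc zero) = true
c4Adj (suc (suc zero)) (suc (suc (suc zero))) = true
c4Adj (suc (suc (suc zero))) (suc (suc zero)) = true
c4Adj (suc (suc (suc zero))) zero = true
c4Adj zero (suc (suc (suc zero))) = true
c4Adj _ _ = false

p4Adj : Fin 4 → Fin 4 → Bool
p4Adj zero (suc zero) = true
p4Adj (suc zero) zero = true
p4Adj (suc zero) (suc (suc zero)) = true
p4Adj (suc (suc zero)) (suc zero) = true
p4Adj (suc (suc zero)) (suc (suc (suc zero))) = true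
p4Adj (suc (suc (suc zero))) (suc (suc zero)) = true
p4Adj _ _ = false


Diamond : Graph 4
Diamond = record { adj = diamondAdj ; sym = s ; irrefl = r }
  where
  s : ∀ i j → diamondAdj i j ≡ diamondAdj j i
  s zero zero = refl
  s zero (suc zero) = refl
  s zero (suc (suc zero)) = refl
  s zero (suc (suc (suc zero))) = refl
  s (suc zero) zero = refl
  s (suc zero) (suc zero) = refl
  s (suc zero) (suc (suc zero)) = refl
  s (suc zero) (suc (suc (suc zero))) = refl
  s (suc (suc zero)) zero = refl
  s (suc (suc zero)) (suc zero) = refl
  s (suc (suc zero)) (suc (suc zero)) = refl
  s (suc (suc zero)) (suc (suc (suc zero))) = refl
  s (suc (suc (suc zero))) zero = refl
  s (suc (suc (suc zero))) (suc zero) = refl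
  s (suc (suc (suc zero))) (suc (suc zero)) = refl
  s (suc (suc (suc zero))) (suc (suc (suc zero))) = refl
  r : ∀ i → diamondAdj i i ≡ false
  r zero = refl
  r (suc zero) = refl
  r (suc (suc zero)) = refl
  r (suc (suc (suc zero))) = refl

C4 : Graph 4
C4 = record { adj = c4Adj ; sym = s ; irrefl = r }
  where
  s : ∀ i j → c4Adj i j ≡ c4Adj j i
  s zero zero = refl
  s zero (suc zero) = refl
  s zero (suc (suc zero)) = refl
  s zero (suc (suc (suc zero))) = refl
  s (suc zero) zero = refl
  s (suc zero) (suc zero) = refl
  s (suc zero) (suc (suc zero)) = refl
  s (suc zero) (suc (suc (suc zero))) = refl
  s (suc (suc zero)) zero = refl
  s (suc (suc zero)) (suc zero) = refl
  s (suc (suc zero)) (suc (suc zero)) = refl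
  s (suc (suc zero)) (suc (suc (suc zero))) = refl
  s (suc (suc (suc zero))) zero = refl
  s (suc (suc (suc zero))) (suc zero) = refl
  s (suc (suc (suc zero))) (suc (suc zero)) = refl
  s (suc (suc (suc zero))) (suc (suc (suc zero))) = refl
  r : ∀ i → c4Adj i i ≡ false
  r zero = refl
  r (suc zero) = refl
  r (suc (suc zero)) = refl
  r (suc (suc (suc zero))) = refl

P4 : Graph 4
P4 = record { adj = p4Adj ; sym = s ; irrefl = r }
  where
  s : ∀ i j → p4Adj i j ≡ p4Adj j i
  s zero zero = refl
  s zero (suc zero) = refl
  s zero (suc (suc zero)) = refl
  s zero (suc (suc (suc zero))) = refl
  s (suc zero) zero = refl
  s (suc zero) (suc zero) = refl
  s (suc zero) (suc (suc zero)) = refl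
  s (suc zero) (suc (suc (suc zero))) = refl
  s (suc (suc zero)) zero = refl
  s (suc (suc zero)) (suc zero) = refl
  s (suc (suc zero)) (suc (suc zero)) = refl
  s (suc (suc zero)) (suc (suc (suc zero))) = refl
  s (suc (suc (suc zero))) zero = refl
  s (suc (suc (suc zero))) (suc zero) = refl
  s (suc (suc (suc zero))) (suc (suc zero)) = refl
  s (suc (suc (suc zero))) (suc (suc (suc zero))) = refl
  r : ∀ i → p4Adj i i ≡ false
  r zero = refl
  r (suc zero) = refl
  r (suc (suc zero)) = refl
  r (suc (suc (suc zero))) = refl

EdgeInCopy : {m n : ℕ} {F : Graph m} {G : Graph n} →
             Embedding F G → Fin n → Fin n → Set
EdgeInCopy {m} {F = F} (g , _) a b =
  Σ (Fin m) λ i → Σ (Fin m) λ j → Adj F i j × g i ≡ a × g j ≡ b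

NonAdjEdgesIn : {m n : ℕ} → Graph m → Graph n → Set
NonAdjEdgesIn F G = ∀ a b c d → Adj G a b → Adj G c d →
  a ≢ c → a ≢ d → b ≢ c → b ≢ d →
  Σ (Embedding F G) λ e → EdgeInCopy {F = F} {G = G} e a b × EdgeInCopy {F = F} {G = G} e c d

{-# OPTIONS --safe #-}
-- Two non-adjacent vertices of L(G) are disjoint edges ab, cd of G, and their common
-- neighbours in L(G) are exactly the edges of G joining {a, b} to {c, d}; an edge ab of G
-- has degree deg a + deg b - 2 in L(G), so L(G) is regular when G is.  Hence L(G) is
-- pseudo strongly regular with parameter μ iff any two disjoint edges of G are joined by
-- exactly μ edges, and the three parts are the combinatorics of this condition.
-- For μ = 4: if i, j were non-adjacent, edges ix and jy (y ≠ x) would be disjoint and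
-- joined by four edges, among them ij.  For μ ≤ 2: three joining edges span a diamond.
-- Two joining edges form either a matching, i.e. a C4 through ab and cd, or a star at one
-- vertex, say at a; then b has a neighbour x outside {a, c, d} by regularity, and the
-- joining edges of bx and cd yield a diamond (μ = 2) or a C4 (μ = 1).  A single joining
-- edge is a P4 through ab and cd.
module Submission where

open import Defs
open import Data.Nat using (ℕ; _≤_)
open import Data.Product using (_×_)
open import Function.Bundles using (_⇔_)

import Data.Bool as Bool
open import Data.Bool using (Bool; true; false; _∧_; _∨_; not; if_then_else_; T)
open import Data.Bool.ListAction using (or)
open import Data.Bool.Properties using (T-∧; T-≡; ∧-zeroʳ; ∧-identityʳ; ∧-conicalˡ; ∧-conicalʳ)
open import Data.Empty using (⊥; ⊥-elim)
open import Data.Fin using (Fin; zero; suc; toℕ)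
open import Data.Fin.Properties using (_≟_; suc-injective; toℕ-injective; all?; injective⇒≤)
open import Data.List using (List; []; _∷_; _++_; map; allFin; tabulate; cartesianProduct; filterᵇ)
open import Data.List.Properties using (map-tabulate)
open import Data.List.Membership.Propositional using (_∈_)
open import Data.List.Membership.Propositional.Properties
  using (∈-filter⁺; ∈-filter⁻; ∈-allFin; ∈-cartesianProduct⁺)
open import Data.List.Relation.Unary.All using (All; []; _∷_)
open import Data.List.Relation.Unary.AllPairs using (AllPairs; []; _∷_)
open import Data.List.Relation.Unary.Any using (here; there)
open import Data.Nat using (zero; suc; _+_; _*_; _∸_; _<_; z≤n; s≤s; _<ᵇ_; _≡ᵇ_)
import Data.Nat.Properties as ℕ
open import Algebra.Properties.CommutativeSemigroup ℕ.+-commutativeSemigroup using (interchange)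
open import Data.Nat.Tactic.RingSolver using (solve-∀)
open import Data.Product using (Σ; ∃; _,_; proj₁; proj₂)
import Data.Product as Prod
open import Data.Sum using (_⊎_; inj₁; inj₂)
import Data.Sum as Sum
open import Data.Vec using (Vec; []; _∷_)
open import Function using (_∘_; const; id)
open import Function.Bundles using (Equivalence; Injection; mk⇔)
open import Function.Construct.Identity using (↔-id)
open import Function.Properties.Inverse using (↔⇒↣)
open import Relation.Binary using (Decidable; tri<; tri≈; tri>)
open import Relation.Binary.PropositionalEquality
  using (_≡_; _≢_; refl; trans; cong; cong₂; subst; ≢-sym; module ≡-Reasoning)
  renaming (sym to ≡-sym)
open import Relation.Nullary using (¬_)
open import Relation.Nullary.Decidable
  using (yes; no; T?; dec-true; dec-false; isYes≗does; ⌊⌋-map′; toWitness; ¬?; _×-dec_; _⊎-dec_; _→-dec_)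

open Equivalence using (to; from)

⟦_⟧ : Bool → ℕ
⟦ false ⟧ = 0
⟦ true  ⟧ = 1

⟦⟧≤1 : ∀ b → ⟦ b ⟧ ≤ 1
⟦⟧≤1 false = z≤n
⟦⟧≤1 true  = s≤s z≤n

⟦⟧+⟦⟧≡2 : ∀ {p q} → ⟦ p ⟧ + ⟦ q ⟧ ≡ 2 → p ≡ true × q ≡ true
⟦⟧+⟦⟧≡2 {true}  {true}  _  = refl , refl
⟦⟧+⟦⟧≡2 {true}  {false} ()
⟦⟧+⟦⟧≡2 {false} {true}  ()
⟦⟧+⟦⟧≡2 {false} {false} ()

⟦∨⟧-disjoint : ∀ p q → T (not (p ∧ q)) → ⟦ p ∨ q ⟧ ≡ ⟦ p ⟧ + ⟦ q ⟧
⟦∨⟧-disjoint true  false _ = refl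
⟦∨⟧-disjoint false q     _ = refl

T-∧-intro : ∀ {x y} → T x → T y → T (x ∧ y)
T-∧-intro p q = from T-∧ (p , q)

allBits : ∀ m → (Vec Bool m → Bool) → Bool
allBits zero    f = f []
allBits (suc m) f = allBits m (f ∘ (true ∷_)) ∧ allBits m (f ∘ (false ∷_))

allBits-sound : ∀ m (f : Vec Bool m → Bool) → T (allBits m f) → ∀ bs → T (f bs)
allBits-sound zero    f h []           = h
allBits-sound (suc m) f h (true  ∷ bs) = allBits-sound m _ (proj₁ (to T-∧ h)) bs
allBits-sound (suc m) f h (false ∷ bs) = allBits-sound m _ (proj₂ (to T-∧ h)) bs

allBits-⇒ : ∀ m (p q : Vec Bool m → Bool) →
  T (allBits m (λ bs → not (p bs) ∨ q bs)) → ∀ bs → T (p bs) → T (q bs)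
allBits-⇒ m p q check bs pbs with p bs | allBits-sound m _ check bs
... | true | qbs = qbs

atMostOne : List Bool → Bool
atMostOne []       = true
atMostOne (b ∷ bs) = not (b ∧ or bs) ∧ atMostOne bs

<ᵇ-true : ∀ {m n} → m < n → (m <ᵇ n) ≡ true
<ᵇ-true = to T-≡ ∘ ℕ.<⇒<ᵇ

<ᵇ-false : ∀ {m n} → ¬ m < n → (m <ᵇ n) ≡ false
<ᵇ-false {m} {n} m≮n = dec-false (T? (m <ᵇ n)) (m≮n ∘ ℕ.<ᵇ⇒< m n)

module _ {n : ℕ} where

  eqᵇ-refl : (x : Fin n) → eqᵇ x x ≡ true
  eqᵇ-refl x = trans (isYes≗does (x ≟ x)) (dec-true (x ≟ x) refl)

  eqᵇ-≢ : {x y : Fin n} → x ≢ y → eqᵇ x y ≡ false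
  eqᵇ-≢ {x} {y} x≢y = trans (isYes≗does (x ≟ y)) (dec-false (x ≟ y) x≢y)

  eqᵇ-true⇒≡ : {x y : Fin n} → eqᵇ x y ≡ true → x ≡ y
  eqᵇ-true⇒≡ {x} {y} eq = toWitness {a? = x ≟ y} (from T-≡ eq)

  eqᵇ-false⇒≢ : {x y : Fin n} → eqᵇ x y ≡ false → x ≢ y
  eqᵇ-false⇒≢ {x} eq refl with () ← trans (≡-sym (eqᵇ-refl x)) eq

  eqᵇ-suc : (v x : Fin n) → eqᵇ (suc v) (suc x) ≡ eqᵇ v x
  eqᵇ-suc v x = ⌊⌋-map′ (cong suc) suc-injective (v ≟ x)

  not-both : {x y u v : Fin n} → (x ≡ u → y ≡ v → ⊥) → T (not (eqᵇ x u ∧ eqᵇ y v))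
  not-both {x} {y} {u} {v} ¬both with x ≟ u | y ≟ v
  ... | yes x≡u | yes y≡v = ¬both x≡u y≡v
  ... | yes _   | no _    = _
  ... | no _    | _       = _

  or-eqᵇ-false : ∀ {w : Fin n} {xs} → All (w ≢_) xs → or (map (λ x → eqᵇ x w) xs) ≡ false
  or-eqᵇ-false []           = refl
  or-eqᵇ-false (w≢x ∷ w≢xs) rewrite eqᵇ-≢ (≢-sym w≢x) = or-eqᵇ-false w≢xs

  atMostOne-eqᵇ : ∀ (w : Fin n) {xs} → AllPairs _≢_ xs → T (atMostOne (map (λ x → eqᵇ x w) xs))
  atMostOne-eqᵇ w []                         = _
  atMostOne-eqᵇ w {x ∷ xs} (x≢xs ∷ distinct) = T-∧-intro first (atMostOne-eqᵇ w distinct)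
    where
    first : T (not (eqᵇ x w ∧ or (map (λ y → eqᵇ y w) xs)))
    first with x ≟ w
    ... | yes refl rewrite or-eqᵇ-false x≢xs = _
    ... | no _ = _

∑ : {A : Set} → List A → (A → ℕ) → ℕ
∑ []       f = 0
∑ (x ∷ xs) f = f x + ∑ xs f

module _ {A : Set} where

  ∑-cong : ∀ {f g : A → ℕ} xs → (∀ x → x ∈ xs → f x ≡ g x) → ∑ xs f ≡ ∑ xs g
  ∑-cong []       eq = refl
  ∑-cong (x ∷ xs) eq = cong₂ _+_ (eq x (here refl)) (∑-cong xs (λ y → eq y ∘ there))

  ∑-mono : ∀ {f g : A → ℕ} xs → (∀ x → f x ≤ g x) → ∑ xs f ≤ ∑ xs g
  ∑-mono []       le = z≤n
  ∑-mono (x ∷ xs) le = ℕ.+-mono-≤ (le x) (∑-mono xs le)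

  ∑-+ : ∀ (f g : A → ℕ) xs → ∑ xs (λ x → f x + g x) ≡ ∑ xs f + ∑ xs g
  ∑-+ f g []       = refl
  ∑-+ f g (x ∷ xs) =
    trans (cong (f x + g x +_) (∑-+ f g xs)) (interchange (f x) (g x) (∑ xs f) (∑ xs g))

  ∑-*ˡ : ∀ k (f : A → ℕ) xs → ∑ xs (λ x → k * f x) ≡ k * ∑ xs f
  ∑-*ˡ k f []       = ≡-sym (ℕ.*-zeroʳ k)
  ∑-*ˡ k f (x ∷ xs) =
    trans (cong (k * f x +_) (∑-*ˡ k f xs)) (≡-sym (ℕ.*-distribˡ-+ k (f x) (∑ xs f)))

  ∑-if : ∀ b (f : A → ℕ) xs → ∑ xs (λ x → if b then f x else 0) ≡ (if b then ∑ xs f else 0)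
  ∑-if true  f xs       = refl
  ∑-if false f []       = refl
  ∑-if false f (x ∷ xs) = ∑-if false f xs

  ∑-++ : ∀ (f : A → ℕ) xs ys → ∑ (xs ++ ys) f ≡ ∑ xs f + ∑ ys f
  ∑-++ f []       ys = refl
  ∑-++ f (x ∷ xs) ys = trans (cong (f x +_) (∑-++ f xs ys)) (≡-sym (ℕ.+-assoc (f x) _ _))

  countB≡∑ : ∀ (p : A → Bool) xs → countB p xs ≡ ∑ xs (⟦_⟧ ∘ p)
  countB≡∑ p []       = refl
  countB≡∑ p (x ∷ xs) with p x
  ... | true  = cong suc (countB≡∑ p xs)
  ... | false = countB≡∑ p xs

  countB-filterᵇ : ∀ (p q : A → Bool) xs → countB p (filterᵇ q xs) ≡ countB (λ x → q x ∧ p x) xs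
  countB-filterᵇ p q []       = refl
  countB-filterᵇ p q (x ∷ xs) with q x
  ... | false = countB-filterᵇ p q xs
  ... | true with p x
  ...   | true  = cong suc (countB-filterᵇ p q xs)
  ...   | false = countB-filterᵇ p q xs

  countB-witness : ∀ (p : A → Bool) xs → 1 ≤ countB p xs → ∃ λ x → x ∈ xs × p x ≡ true
  countB-witness p (x ∷ xs) h with p x in px
  ... | true  = x , here refl , px
  ... | false = let y , y∈xs , py = countB-witness p xs h in y , there y∈xs , py

∑-map : ∀ {A B : Set} (f : B → ℕ) (g : A → B) xs → ∑ (map g xs) f ≡ ∑ xs (f ∘ g)
∑-map f g []       = refl
∑-map f g (x ∷ xs) = cong (f (g x) +_) (∑-map f g xs)

∑-cartesianProduct : ∀ {A B : Set} (f : A × B → ℕ) xs ys →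
  ∑ (cartesianProduct xs ys) f ≡ ∑ xs (λ x → ∑ ys (λ y → f (x , y)))
∑-cartesianProduct f []       ys = refl
∑-cartesianProduct f (x ∷ xs) ys =
  trans (∑-++ f (map (x ,_) ys) _) (cong₂ _+_ (∑-map f (x ,_) ys) (∑-cartesianProduct f xs ys))

∑-allFin-suc : ∀ {n} (f : Fin (suc n) → ℕ) → ∑ (allFin (suc n)) f ≡ f zero + ∑ (allFin n) (f ∘ suc)
∑-allFin-suc {n} f = cong (f zero +_) (begin
  ∑ (tabulate suc) f         ≡⟨ cong (λ xs → ∑ xs f) (≡-sym (map-tabulate id suc)) ⟩
  ∑ (map suc (allFin n)) f   ≡⟨ ∑-map f suc (allFin n) ⟩
  ∑ (allFin n) (f ∘ suc)     ∎)
  where open ≡-Reasoning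

∑-allFin-δ : ∀ {n} (v : Fin n) (f : Fin n → ℕ) →
  ∑ (allFin n) (λ x → if eqᵇ v x then f x else 0) ≡ f v
∑-allFin-δ {suc n} zero f =
  trans (∑-allFin-suc (λ x → if eqᵇ zero x then f x else 0))
        (trans (cong (f zero +_) (∑-if false (f ∘ suc) (allFin n))) (ℕ.+-identityʳ (f zero)))
∑-allFin-δ {suc n} (suc v) f =
  trans (∑-allFin-suc (λ x → if eqᵇ (suc v) x then f x else 0))
        (trans (∑-cong (allFin n) (λ x _ → cong (λ b → if b then f (suc x) else 0) (eqᵇ-suc v x)))
               (∑-allFin-δ v (f ∘ suc)))

record Distinct4 {n : ℕ} (a b c d : Fin n) : Set where
  constructor distinct4
  field
    a≢b : a ≢ b
    a≢c : a ≢ c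
    a≢d : a ≢ d
    b≢c : b ≢ c
    b≢d : b ≢ d
    c≢d : c ≢ d

  allPairs : AllPairs _≢_ (a ∷ b ∷ c ∷ d ∷ [])
  allPairs = (a≢b ∷ a≢c ∷ a≢d ∷ []) ∷ (b≢c ∷ b≢d ∷ []) ∷ (c≢d ∷ []) ∷ [] ∷ []

module _ {n : ℕ} {a b c d : Fin n} (D : Distinct4 a b c d) where
  open Distinct4 D

  swapˡ : Distinct4 b a c d
  swapˡ = distinct4 (≢-sym a≢b) b≢c b≢d a≢c a≢d c≢d

  swapʳ : Distinct4 a b d c
  swapʳ = distinct4 a≢b a≢d a≢c b≢d b≢c (≢-sym c≢d)

  exchange : Distinct4 c d a b
  exchange = distinct4 c≢d (≢-sym a≢c) (≢-sym b≢c) (≢-sym a≢d) (≢-sym b≢d) a≢b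

pattern #0 = zero
pattern #1 = suc zero
pattern #2 = suc (suc zero)
pattern #3 = suc (suc (suc zero))

quad : {n : ℕ} → Fin n → Fin n → Fin n → Fin n → Fin 4 → Fin n
quad p q r s #0 = p
quad p q r s #1 = q
quad p q r s #2 = r
quad p q r s #3 = s

quad-injective : ∀ {n} {p q r s : Fin n} → Distinct4 p q r s →
  ∀ i j → quad p q r s i ≡ quad p q r s j → i ≡ j
quad-injective D #0 #0 _   = refl
quad-injective D #1 #1 _   = refl
quad-injective D #2 #2 _   = refl
quad-injective D #3 #3 _   = refl
quad-injective D #0 #1 p≡q = ⊥-elim (Distinct4.a≢b D p≡q)
quad-injective D #0 #2 p≡r = ⊥-elim (Distinct4.a≢c D p≡r)
quad-injective D #0 #3 p≡s = ⊥-elim (Distinct4.a≢d D p≡s)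
quad-injective D #1 #2 q≡r = ⊥-elim (Distinct4.b≢c D q≡r)
quad-injective D #1 #3 q≡s = ⊥-elim (Distinct4.b≢d D q≡s)
quad-injective D #2 #3 r≡s = ⊥-elim (Distinct4.c≢d D r≡s)
quad-injective D #1 #0 q≡p = ⊥-elim (Distinct4.a≢b D (≡-sym q≡p))
quad-injective D #2 #0 r≡p = ⊥-elim (Distinct4.a≢c D (≡-sym r≡p))
quad-injective D #3 #0 s≡p = ⊥-elim (Distinct4.a≢d D (≡-sym s≡p))
quad-injective D #2 #1 r≡q = ⊥-elim (Distinct4.b≢c D (≡-sym r≡q))
quad-injective D #3 #1 s≡q = ⊥-elim (Distinct4.b≢d D (≡-sym s≡q))
quad-injective D #3 #2 s≡r = ⊥-elim (Distinct4.c≢d D (≡-sym s≡r))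

Distinct4⇒4≤n : ∀ {n} {a b c d : Fin n} → Distinct4 a b c d → 4 ≤ n
Distinct4⇒4≤n {a = a} {b} {c} {d} D = injective⇒≤ {f = quad a b c d} (quad-injective D _ _)

module _ {n : ℕ} (G : Graph n) where

  Adj-sym : ∀ {x y} → Adj G x y → Adj G y x
  Adj-sym {x} {y} xy = trans (sym G y x) xy

  nonAdj-sym : ∀ {x y} → adj G x y ≡ false → adj G y x ≡ false
  nonAdj-sym {x} {y} xy = trans (sym G y x) xy

  Adj⇒≢ : ∀ {x y} → Adj G x y → x ≢ y
  Adj⇒≢ {x} xx refl with () ← trans (≡-sym xx) (irrefl G x)

  Adj-nonAdj⇒≢ : ∀ {x y z} → Adj G x y → adj G x z ≡ false → y ≢ z
  Adj-nonAdj⇒≢ xy xz refl with () ← trans (≡-sym xy) xz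

  Adj? : Decidable (Adj G)
  Adj? x y = adj G x y Bool.≟ true

-- For disjoint edges ab and cd this is the number of their common neighbours in L(G).
joins : {n : ℕ} → Graph n → (a b c d : Fin n) → ℕ
joins G a b c d = ⟦ adj G a c ⟧ + ⟦ adj G a d ⟧ + ⟦ adj G b c ⟧ + ⟦ adj G b d ⟧

-- Up to the symmetries of two disjoint edges, a Star is the only way for two joining
-- edges not to be Matched.
Matched Joined Star : {n : ℕ} → Graph n → (a b c d : Fin n) → Set
Matched H a b c d = (Adj H a c × Adj H b d) ⊎ (Adj H a d × Adj H b c)
Joined  H a b c d = Adj H a c ⊎ Adj H a d ⊎ Adj H b c ⊎ Adj H b d
Star    H a b c d = Adj H a c × Adj H a d × adj H b c ≡ false × adj H b d ≡ false

C4-disjointEdges-matched : ∀ i j k l → Adj C4 i j → Adj C4 k l →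
  i ≢ k → i ≢ l → j ≢ k → j ≢ l → Matched C4 i j k l
C4-disjointEdges-matched = toWitness {a? = all? λ i → all? λ j → all? λ k → all? λ l →
  Adj? C4 i j →-dec Adj? C4 k l →-dec
  ¬? (i ≟ k) →-dec ¬? (i ≟ l) →-dec ¬? (j ≟ k) →-dec ¬? (j ≟ l) →-dec
  ((Adj? C4 i k ×-dec Adj? C4 j l) ⊎-dec (Adj? C4 i l ×-dec Adj? C4 j k))} _

P4-disjointEdges-joined : ∀ i j k l → Adj P4 i j → Adj P4 k l →
  i ≢ k → i ≢ l → j ≢ k → j ≢ l → Joined P4 i j k l
P4-disjointEdges-joined = toWitness {a? = all? λ i → all? λ j → all? λ k → all? λ l →
  Adj? P4 i j →-dec Adj? P4 k l →-dec
  ¬? (i ≟ k) →-dec ¬? (i ≟ l) →-dec ¬? (j ≟ k) →-dec ¬? (j ≟ l) →-dec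
  (Adj? P4 i k ⊎-dec Adj? P4 i l ⊎-dec Adj? P4 j k ⊎-dec Adj? P4 j l)} _

module _ {m n : ℕ} {F : Graph m} {G : Graph n} where

  Matched-image : ∀ (e : Embedding F G) {i j k l} →
    Matched F i j k l → Matched G (proj₁ e i) (proj₁ e j) (proj₁ e k) (proj₁ e l)
  Matched-image (_ , _ , edges) =
    Sum.map (Prod.map (edges _ _) (edges _ _)) (Prod.map (edges _ _) (edges _ _))

  Joined-image : ∀ (e : Embedding F G) {i j k l} →
    Joined F i j k l → Joined G (proj₁ e i) (proj₁ e j) (proj₁ e k) (proj₁ e l)
  Joined-image (_ , _ , edges) =
    Sum.map (edges _ _) (Sum.map (edges _ _) (Sum.map (edges _ _) (edges _ _)))

  image-distinct4 : ∀ (e : Embedding F G) {i j k l} →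
    Distinct4 i j k l → Distinct4 (proj₁ e i) (proj₁ e j) (proj₁ e k) (proj₁ e l)
  image-distinct4 (_ , injective , _) (distinct4 i≢j i≢k i≢l j≢k j≢l k≢l) =
    distinct4 (i≢j ∘ injective _ _) (i≢k ∘ injective _ _) (i≢l ∘ injective _ _)
              (j≢k ∘ injective _ _) (j≢l ∘ injective _ _) (k≢l ∘ injective _ _)

distinct-0123 : Distinct4 {4} #0 #1 #2 #3
distinct-0123 = distinct4 (λ ()) (λ ()) (λ ()) (λ ()) (λ ()) (λ ())

distinct-0213 : Distinct4 {4} #0 #2 #1 #3
distinct-0213 = distinct4 (λ ()) (λ ()) (λ ()) (λ ()) (λ ()) (λ ())

K4⇒Diamond : {n : ℕ} {G : Graph n} → Embedding (K 4) G → Embedding Diamond G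
K4⇒Diamond (g , injective , edges) = g , injective , λ i j ij → edges i j (∧-conicalˡ _ _ ij)

-- Counting in the line graph

-- For an edge (u , v) the bits stand for eqᵇ a u, eqᵇ a v, eqᵇ b u, eqᵇ b v, …, so that
-- lineAdj (a , b) (u , v) is by definition lineAdjᵇ A₁ A₂ B₁ B₂; the two counting identities
-- for L(G) thus reduce pointwise to Boolean tautologies, which allBits verifies.
lineAdjᵇ connectsᵇ : Bool → Bool → Bool → Bool → Bool
lineAdjᵇ  A₁ A₂ B₁ B₂ = not (A₁ ∧ B₂) ∧ (A₁ ∨ A₂ ∨ B₁ ∨ B₂)
connectsᵇ X₁ X₂ Y₁ Y₂ = (X₁ ∧ Y₂) ∨ (Y₁ ∧ X₂)

lineDegree-premise lineDegree-conclusion : Vec Bool 4 → Bool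
lineDegree-premise (A₁ ∷ A₂ ∷ B₁ ∷ B₂ ∷ []) =
  atMostOne (A₁ ∷ B₁ ∷ []) ∧ atMostOne (A₂ ∷ B₂ ∷ []) ∧ not (B₁ ∧ A₂)
lineDegree-conclusion (A₁ ∷ A₂ ∷ B₁ ∷ B₂ ∷ []) =
  ⟦ A₁ ∨ A₂ ⟧ + ⟦ B₁ ∨ B₂ ⟧ ≡ᵇ ⟦ lineAdjᵇ A₁ A₂ B₁ B₂ ⟧ + 2 * ⟦ A₁ ∧ B₂ ⟧

commonNeighbours-premise commonNeighbours-conclusion : Vec Bool 8 → Bool
commonNeighbours-premise (A₁ ∷ A₂ ∷ B₁ ∷ B₂ ∷ C₁ ∷ C₂ ∷ D₁ ∷ D₂ ∷ []) =
  atMostOne (A₁ ∷ B₁ ∷ C₁ ∷ D₁ ∷ []) ∧ atMostOne (A₂ ∷ B₂ ∷ C₂ ∷ D₂ ∷ [])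
commonNeighbours-conclusion (A₁ ∷ A₂ ∷ B₁ ∷ B₂ ∷ C₁ ∷ C₂ ∷ D₁ ∷ D₂ ∷ []) =
  ⟦ lineAdjᵇ A₁ A₂ B₁ B₂ ∧ lineAdjᵇ C₁ C₂ D₁ D₂ ⟧ ≡ᵇ
  ⟦ connectsᵇ A₁ A₂ C₁ C₂ ⟧ + ⟦ connectsᵇ A₁ A₂ D₁ D₂ ⟧ +
  ⟦ connectsᵇ B₁ B₂ C₁ C₂ ⟧ + ⟦ connectsᵇ B₁ B₂ D₁ D₂ ⟧

lineAdjᵇ-false : ∀ P Q R S → lineAdjᵇ P Q R S ≡ false →
  P ∧ S ≡ true ⊎ (P ≡ false × Q ≡ false × R ≡ false × S ≡ false)
lineAdjᵇ-false true  _     _     true  _  = inj₁ refl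
lineAdjᵇ-false true  _     _     false ()
lineAdjᵇ-false false true  _     _     ()
lineAdjᵇ-false false false true  _     ()
lineAdjᵇ-false false false false true  ()
lineAdjᵇ-false false false false false _  = inj₂ (refl , refl , refl , refl)

module _ {n : ℕ} (G : Graph n) where

  degree : Fin n → ℕ
  degree v = countB (adj G v) (allFin n)

  Regular : ℕ → Set
  Regular k = ∀ v → degree v ≡ k

  edgeᵇ : Edge n → Bool
  edgeᵇ (a , b) = (toℕ a <ᵇ toℕ b) ∧ adj G a b

  private
    pairs : List (Edge n)
    pairs = cartesianProduct (allFin n) (allFin n)

  ∈-edgeList⁻ : ∀ {a b} → (a , b) ∈ edgeList G → toℕ a < toℕ b × Adj G a b
  ∈-edgeList⁻ {a} {b} ab∈ =
    let a<ᵇb , ab = to T-∧ (proj₂ (∈-filter⁻ (T? ∘ edgeᵇ) {xs = pairs} ab∈))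
    in ℕ.<ᵇ⇒< (toℕ a) (toℕ b) a<ᵇb , to T-≡ ab

  ∈-edgeList⁺ : ∀ {a b} → toℕ a < toℕ b → Adj G a b → (a , b) ∈ edgeList G
  ∈-edgeList⁺ {a} {b} a<b ab =
    ∈-filter⁺ (T? ∘ edgeᵇ) {xs = pairs} (∈-cartesianProduct⁺ (∈-allFin a) (∈-allFin b))
      (T-∧-intro (ℕ.<⇒<ᵇ a<b) (from T-≡ ab))

  Adj⇒∈-edgeList : ∀ {a b} → Adj G a b → (a , b) ∈ edgeList G ⊎ (b , a) ∈ edgeList G
  Adj⇒∈-edgeList {a} {b} ab with ℕ.<-cmp (toℕ a) (toℕ b)
  ... | tri< a<b _ _ = inj₁ (∈-edgeList⁺ a<b ab)
  ... | tri≈ _ a≡b _ = ⊥-elim (Adj⇒≢ G ab (toℕ-injective a≡b))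
  ... | tri> _ _ b<a = inj₂ (∈-edgeList⁺ b<a (Adj-sym G ab))

  edgeᵇ-orientations : ∀ x y → ⟦ edgeᵇ (x , y) ⟧ + ⟦ edgeᵇ (y , x) ⟧ ≡ ⟦ adj G x y ⟧
  edgeᵇ-orientations x y with ℕ.<-cmp (toℕ x) (toℕ y)
  ... | tri< x<y _ y≮x rewrite <ᵇ-true x<y | <ᵇ-false y≮x = ℕ.+-identityʳ _
  ... | tri> x≮y _ y<x rewrite <ᵇ-false x≮y | <ᵇ-true y<x = cong ⟦_⟧ (sym G y x)
  ... | tri≈ x≮y x≡y _ with refl ← toℕ-injective x≡y rewrite <ᵇ-false x≮y | irrefl G x = refl

  countB-edgeList : ∀ p → countB p (edgeList G) ≡
    ∑ (allFin n) λ x → ∑ (allFin n) λ y → ⟦ edgeᵇ (x , y) ∧ p (x , y) ⟧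
  countB-edgeList p =
    trans (countB-filterᵇ p edgeᵇ pairs)
          (trans (countB≡∑ (λ z → edgeᵇ z ∧ p z) pairs) (∑-cartesianProduct _ (allFin n) (allFin n)))

  isPair : Fin n → Fin n → Edge n → Bool
  isPair x y (u , v) = eqᵇ x u ∧ eqᵇ y v

  incident : Fin n → Edge n → Bool
  incident w (u , v) = eqᵇ w u ∨ eqᵇ w v

  connects : Fin n → Fin n → Edge n → Bool
  connects x y z = isPair x y z ∨ isPair y x z

  countB-isPair : ∀ x y → countB (isPair x y) (edgeList G) ≡ ⟦ edgeᵇ (x , y) ⟧
  countB-isPair x y = begin
    countB (isPair x y) (edgeList G)
      ≡⟨ countB-edgeList (isPair x y) ⟩
    ∑ (allFin n) (λ u → ∑ (allFin n) λ v → ⟦ edgeᵇ (u , v) ∧ isPair x y (u , v) ⟧)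
      ≡⟨ ∑-cong (allFin n) (λ u _ → ∑-cong (allFin n) λ v _ → split u v) ⟩
    ∑ (allFin n) (λ u → ∑ (allFin n) λ v → if eqᵇ x u then atY v else 0)
      ≡⟨ ∑-cong (allFin n) (λ u _ → ∑-if (eqᵇ x u) atY (allFin n)) ⟩
    ∑ (allFin n) (λ u → if eqᵇ x u then ∑ (allFin n) atY else 0)
      ≡⟨ ∑-allFin-δ x (const (∑ (allFin n) atY)) ⟩
    ∑ (allFin n) atY
      ≡⟨ ∑-allFin-δ y (const ⟦ edgeᵇ (x , y) ⟧) ⟩
    ⟦ edgeᵇ (x , y) ⟧ ∎
    where
    open ≡-Reasoning
    atY : Fin n → ℕ
    atY v = if eqᵇ y v then ⟦ edgeᵇ (x , y) ⟧ else 0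
    split : ∀ u v → ⟦ edgeᵇ (u , v) ∧ isPair x y (u , v) ⟧ ≡ (if eqᵇ x u then atY v else 0)
    split u v with x ≟ u | y ≟ v
    ... | yes refl | yes refl = cong ⟦_⟧ (∧-identityʳ _)
    ... | yes refl | no _     = cong ⟦_⟧ (∧-zeroʳ _)
    ... | no _     | _        = cong ⟦_⟧ (∧-zeroʳ _)

  countB-incident : ∀ w → countB (incident w) (edgeList G) ≡ degree w
  countB-incident w = begin
    countB (incident w) (edgeList G)
      ≡⟨ countB-edgeList (incident w) ⟩
    ∑ (allFin n) (λ u → ∑ (allFin n) λ v → ⟦ edgeᵇ (u , v) ∧ incident w (u , v) ⟧)
      ≡⟨ ∑-cong (allFin n) (λ u _ → ∑-cong (allFin n) λ v _ → split u v) ⟩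
    ∑ (allFin n) (λ u → ∑ (allFin n) λ v → (if eqᵇ w u then out v else 0) + (if eqᵇ w v then into u else 0))
      ≡⟨ ∑-cong (allFin n) (λ u _ →
           trans (∑-+ _ _ (allFin n)) (cong₂ _+_ (∑-if (eqᵇ w u) out (allFin n)) (∑-allFin-δ w (const (into u))))) ⟩
    ∑ (allFin n) (λ u → (if eqᵇ w u then ∑ (allFin n) out else 0) + into u)
      ≡⟨ ∑-+ _ into (allFin n) ⟩
    ∑ (allFin n) (λ u → if eqᵇ w u then ∑ (allFin n) out else 0) + ∑ (allFin n) into
      ≡⟨ cong (_+ ∑ (allFin n) into) (∑-allFin-δ w (const (∑ (allFin n) out))) ⟩
    ∑ (allFin n) out + ∑ (allFin n) into
      ≡⟨ ≡-sym (∑-+ out into (allFin n)) ⟩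
    ∑ (allFin n) (λ v → out v + into v)
      ≡⟨ ∑-cong (allFin n) (λ v _ → edgeᵇ-orientations w v) ⟩
    ∑ (allFin n) (⟦_⟧ ∘ adj G w)
      ≡⟨ ≡-sym (countB≡∑ (adj G w) (allFin n)) ⟩
    degree w ∎
    where
    open ≡-Reasoning
    out into : Fin n → ℕ
    out  v = ⟦ edgeᵇ (w , v) ⟧
    into u = ⟦ edgeᵇ (u , w) ⟧
    split : ∀ u v → ⟦ edgeᵇ (u , v) ∧ incident w (u , v) ⟧ ≡
                    (if eqᵇ w u then out v else 0) + (if eqᵇ w v then into u else 0)
    split u v with w ≟ u | w ≟ v
    ... | yes refl | yes refl rewrite irrefl G w | ∧-zeroʳ (toℕ w <ᵇ toℕ w) = refl
    ... | yes refl | no _     = trans (cong ⟦_⟧ (∧-identityʳ _)) (≡-sym (ℕ.+-identityʳ _))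
    ... | no _     | yes refl = cong ⟦_⟧ (∧-identityʳ _)
    ... | no _     | no _     = cong ⟦_⟧ (∧-zeroʳ _)

  lineDegree : ∀ {a b} → (a , b) ∈ edgeList G →
    countB (lineAdj (a , b)) (edgeList G) + 2 ≡ degree a + degree b
  lineDegree {a} {b} ab∈ = ≡-sym (begin
    degree a + degree b
      ≡⟨ ≡-sym (cong₂ _+_ (countB-incident a) (countB-incident b)) ⟩
    countB (incident a) E + countB (incident b) E
      ≡⟨ cong₂ _+_ (countB≡∑ (incident a) E) (countB≡∑ (incident b) E) ⟩
    ∑ E (⟦_⟧ ∘ incident a) + ∑ E (⟦_⟧ ∘ incident b)
      ≡⟨ ≡-sym (∑-+ _ _ E) ⟩
    ∑ E (λ z → ⟦ incident a z ⟧ + ⟦ incident b z ⟧)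
      ≡⟨ ∑-cong E pointwise ⟩
    ∑ E (λ z → ⟦ lineAdj (a , b) z ⟧ + 2 * ⟦ isPair a b z ⟧)
      ≡⟨ trans (∑-+ _ _ E) (cong (∑ E (⟦_⟧ ∘ lineAdj (a , b)) +_) (∑-*ˡ 2 (⟦_⟧ ∘ isPair a b) E)) ⟩
    ∑ E (⟦_⟧ ∘ lineAdj (a , b)) + 2 * ∑ E (⟦_⟧ ∘ isPair a b)
      ≡⟨ ≡-sym (cong₂ (λ l p → l + 2 * p) (countB≡∑ (lineAdj (a , b)) E) (countB≡∑ (isPair a b) E)) ⟩
    countB (lineAdj (a , b)) E + 2 * countB (isPair a b) E
      ≡⟨ cong (λ p → countB (lineAdj (a , b)) E + 2 * p) (countB-isPair a b) ⟩
    countB (lineAdj (a , b)) E + 2 * ⟦ edgeᵇ (a , b) ⟧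
      ≡⟨ cong (λ e → countB (lineAdj (a , b)) E + 2 * ⟦ e ⟧) ab-listed ⟩
    countB (lineAdj (a , b)) E + 2 ∎)
    where
    open ≡-Reasoning
    E = edgeList G
    a<b : toℕ a < toℕ b
    a<b = proj₁ (∈-edgeList⁻ ab∈)
    ab-listed : edgeᵇ (a , b) ≡ true
    ab-listed rewrite <ᵇ-true a<b = proj₂ (∈-edgeList⁻ ab∈)
    a≢b : AllPairs _≢_ (a ∷ b ∷ [])
    a≢b = ((λ { refl → ℕ.<-irrefl refl a<b }) ∷ []) ∷ [] ∷ []
    pointwise : ∀ z → z ∈ E →
      ⟦ incident a z ⟧ + ⟦ incident b z ⟧ ≡ ⟦ lineAdj (a , b) z ⟧ + 2 * ⟦ isPair a b z ⟧
    pointwise (u , v) uv∈ = ℕ.≡ᵇ⇒≡ _ _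
      (allBits-⇒ 4 lineDegree-premise lineDegree-conclusion _ (eqᵇ a u ∷ eqᵇ a v ∷ eqᵇ b u ∷ eqᵇ b v ∷ [])
        (T-∧-intro (atMostOne-eqᵇ u a≢b) (T-∧-intro (atMostOne-eqᵇ v a≢b)
          -- (u , v) ≠ (b , a), since edges are listed in increasing order.
          (not-both {x = b} {a} {u} {v} λ { refl refl → ℕ.<-asym a<b (proj₁ (∈-edgeList⁻ uv∈)) }))))

  ∑-connects : ∀ {x y} → x ≢ y → ∑ (edgeList G) (⟦_⟧ ∘ connects x y) ≡ ⟦ adj G x y ⟧
  ∑-connects {x} {y} x≢y = begin
    ∑ E (⟦_⟧ ∘ connects x y)
      ≡⟨ ∑-cong E (λ z _ → ⟦∨⟧-disjoint (isPair x y z) (isPair y x z) (exclusive z)) ⟩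
    ∑ E (λ z → ⟦ isPair x y z ⟧ + ⟦ isPair y x z ⟧)
      ≡⟨ ∑-+ _ _ E ⟩
    ∑ E (⟦_⟧ ∘ isPair x y) + ∑ E (⟦_⟧ ∘ isPair y x)
      ≡⟨ ≡-sym (cong₂ _+_ (countB≡∑ (isPair x y) E) (countB≡∑ (isPair y x) E)) ⟩
    countB (isPair x y) E + countB (isPair y x) E
      ≡⟨ cong₂ _+_ (countB-isPair x y) (countB-isPair y x) ⟩
    ⟦ edgeᵇ (x , y) ⟧ + ⟦ edgeᵇ (y , x) ⟧
      ≡⟨ edgeᵇ-orientations x y ⟩
    ⟦ adj G x y ⟧ ∎
    where
    open ≡-Reasoning
    E = edgeList G
    exclusive : ∀ z → T (not (isPair x y z ∧ isPair y x z))
    exclusive (u , v) with x ≟ u | y ≟ u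
    ... | yes refl | yes refl = ⊥-elim (x≢y refl)
    ... | yes refl | no _     = subst (T ∘ not) (≡-sym (∧-zeroʳ (eqᵇ y v))) _
    ... | no _     | _        = _

  commonNeighbours : ∀ {a b c d} → Distinct4 a b c d →
    countB (λ z → lineAdj (a , b) z ∧ lineAdj (c , d) z) (edgeList G) ≡ joins G a b c d
  commonNeighbours {a} {b} {c} {d} D = begin
    countB common E
      ≡⟨ countB≡∑ common E ⟩
    ∑ E (⟦_⟧ ∘ common)
      ≡⟨ ∑-cong E (λ z _ → pointwise z) ⟩
    ∑ E (λ z → ⟦ connects a c z ⟧ + ⟦ connects a d z ⟧ + ⟦ connects b c z ⟧ + ⟦ connects b d z ⟧)
      ≡⟨ trans (∑-+ _ _ E) (cong (_+ _) (trans (∑-+ _ _ E) (cong (_+ _) (∑-+ _ _ E)))) ⟩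
    ∑ E (⟦_⟧ ∘ connects a c) + ∑ E (⟦_⟧ ∘ connects a d) +
    ∑ E (⟦_⟧ ∘ connects b c) + ∑ E (⟦_⟧ ∘ connects b d)
      ≡⟨ cong₂ _+_ (cong₂ _+_ (cong₂ _+_ (∑-connects a≢c) (∑-connects a≢d)) (∑-connects b≢c))
                   (∑-connects b≢d) ⟩
    joins G a b c d ∎
    where
    open ≡-Reasoning
    open Distinct4 D
    E = edgeList G
    common : Edge n → Bool
    common z = lineAdj (a , b) z ∧ lineAdj (c , d) z
    pointwise : ∀ z → ⟦ common z ⟧ ≡
      ⟦ connects a c z ⟧ + ⟦ connects a d z ⟧ + ⟦ connects b c z ⟧ + ⟦ connects b d z ⟧
    pointwise (u , v) = ℕ.≡ᵇ⇒≡ _ _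
      (allBits-⇒ 8 commonNeighbours-premise commonNeighbours-conclusion _
        (eqᵇ a u ∷ eqᵇ a v ∷ eqᵇ b u ∷ eqᵇ b v ∷ eqᵇ c u ∷ eqᵇ c v ∷ eqᵇ d u ∷ eqᵇ d v ∷ [])
        (T-∧-intro (atMostOne-eqᵇ u allPairs) (atMostOne-eqᵇ v allPairs)))

  -- Pseudo strong regularity of L(G)

  ForDisjointEdges : (Fin n → Fin n → Fin n → Fin n → Set) → Set
  ForDisjointEdges P = ∀ {a b c d} → Distinct4 a b c d → Adj G a b → Adj G c d → P a b c d

  JoinedBy : ℕ → Set
  JoinedBy μ = ForDisjointEdges λ a b c d → joins G a b c d ≡ μ

  joins-swapˡ : ∀ a b c d → joins G b a c d ≡ joins G a b c d
  joins-swapˡ a b c d = swapPairs ⟦ adj G a c ⟧ ⟦ adj G a d ⟧ ⟦ adj G b c ⟧ ⟦ adj G b d ⟧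
    where
    swapPairs : ∀ p q r s → r + s + p + q ≡ p + q + r + s
    swapPairs = solve-∀

  joins-swapʳ : ∀ a b c d → joins G a b d c ≡ joins G a b c d
  joins-swapʳ a b c d = swapWithin ⟦ adj G a c ⟧ ⟦ adj G a d ⟧ ⟦ adj G b c ⟧ ⟦ adj G b d ⟧
    where
    swapWithin : ∀ p q r s → q + p + s + r ≡ p + q + r + s
    swapWithin = solve-∀

  lineAdj-distinct : ∀ {a b c d : Fin n} → Distinct4 a b c d → lineAdj (a , b) (c , d) ≡ false
  lineAdj-distinct (distinct4 _ a≢c a≢d b≢c b≢d _)
    rewrite eqᵇ-≢ a≢c | eqᵇ-≢ a≢d | eqᵇ-≢ b≢c | eqᵇ-≢ b≢d = refl

  lineNonAdj⇒distinct : ∀ {a b c d} → (a , b) ∈ edgeList G → (c , d) ∈ edgeList G →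
    (a , b) ≢ (c , d) → lineAdj (a , b) (c , d) ≡ false → Distinct4 a b c d
  lineNonAdj⇒distinct {a} {b} {c} {d} ab∈ cd∈ ab≢cd ab≁cd
    with lineAdjᵇ-false (eqᵇ a c) (eqᵇ a d) (eqᵇ b c) (eqᵇ b d) ab≁cd
  ... | inj₁ same =
    ⊥-elim (ab≢cd (cong₂ _,_ (eqᵇ-true⇒≡ (∧-conicalˡ _ _ same)) (eqᵇ-true⇒≡ (∧-conicalʳ _ _ same))))
  ... | inj₂ (ac , ad , bc , bd) =
    distinct4 (Adj⇒≢ G (proj₂ (∈-edgeList⁻ ab∈))) (eqᵇ-false⇒≢ ac) (eqᵇ-false⇒≢ ad)
              (eqᵇ-false⇒≢ bc) (eqᵇ-false⇒≢ bd) (Adj⇒≢ G (proj₂ (∈-edgeList⁻ cd∈)))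

  linePSR⇒joins : ∀ {μ a b c d} → LinePSR G μ → Distinct4 a b c d →
    (a , b) ∈ edgeList G → (c , d) ∈ edgeList G → joins G a b c d ≡ μ
  linePSR⇒joins (_ , _ , lineCommon) D ab∈ cd∈ =
    trans (≡-sym (commonNeighbours D))
          (lineCommon _ _ ab∈ cd∈ (λ { refl → Distinct4.a≢c D refl }) (lineAdj-distinct D))

  linePSR⇒joinedBy : ∀ {μ} → LinePSR G μ → JoinedBy μ
  linePSR⇒joinedBy L {a} {b} {c} {d} D ab cd with Adj⇒∈-edgeList ab | Adj⇒∈-edgeList cd
  ... | inj₁ ab∈ | inj₁ cd∈ = linePSR⇒joins L D ab∈ cd∈
  ... | inj₂ ba∈ | inj₁ cd∈ = trans (≡-sym (joins-swapˡ a b c d)) (linePSR⇒joins L (swapˡ D) ba∈ cd∈)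
  ... | inj₁ ab∈ | inj₂ dc∈ = trans (≡-sym (joins-swapʳ a b c d)) (linePSR⇒joins L (swapʳ D) ab∈ dc∈)
  ... | inj₂ ba∈ | inj₂ dc∈ =
    trans (≡-sym (trans (joins-swapʳ b a c d) (joins-swapˡ a b c d)))
          (linePSR⇒joins L (swapʳ (swapˡ D)) ba∈ dc∈)

  joinedBy⇒linePSR : ∀ {k μ} → Regular k → JoinedBy μ → LinePSR G μ
  joinedBy⇒linePSR {k} regular joined = k + k ∸ 2 , lineRegular , lineCommon
    where
    -- The degree 2k - 2 of L(G); the truncation of ∸ only matters when k = 0, and then G has no edges.
    lineRegular : ∀ e → e ∈ edgeList G → countB (lineAdj e) (edgeList G) ≡ k + k ∸ 2
    lineRegular (a , b) ab∈ = begin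
      countB (lineAdj (a , b)) (edgeList G)
        ≡⟨ ≡-sym (ℕ.m+n∸n≡m _ 2) ⟩
      countB (lineAdj (a , b)) (edgeList G) + 2 ∸ 2
        ≡⟨ cong (_∸ 2) (trans (lineDegree ab∈) (cong₂ _+_ (regular a) (regular b))) ⟩
      k + k ∸ 2 ∎
      where open ≡-Reasoning
    lineCommon : ∀ e f → e ∈ edgeList G → f ∈ edgeList G → e ≢ f → lineAdj e f ≡ false →
      countB (λ z → lineAdj e z ∧ lineAdj f z) (edgeList G) ≡ _
    lineCommon (a , b) (c , d) ab∈ cd∈ ab≢cd ab≁cd =
      trans (commonNeighbours D) (joined D (proj₂ (∈-edgeList⁻ ab∈)) (proj₂ (∈-edgeList⁻ cd∈)))
      where D = lineNonAdj⇒distinct ab∈ cd∈ ab≢cd ab≁cd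

  degree-≤-avoiding : ∀ v y → degree v ≤ countB (λ x → adj G v x ∧ not (eqᵇ y x)) (allFin n) + 1
  degree-≤-avoiding v y = begin
    degree v
      ≡⟨ countB≡∑ (adj G v) (allFin n) ⟩
    ∑ (allFin n) (⟦_⟧ ∘ adj G v)
      ≤⟨ ∑-mono (allFin n) bound ⟩
    ∑ (allFin n) (λ x → ⟦ adj G v x ∧ not (eqᵇ y x) ⟧ + (if eqᵇ y x then 1 else 0))
      ≡⟨ ∑-+ _ _ (allFin n) ⟩
    ∑ (allFin n) (λ x → ⟦ adj G v x ∧ not (eqᵇ y x) ⟧) + ∑ (allFin n) (λ x → if eqᵇ y x then 1 else 0)
      ≡⟨ cong₂ _+_ (≡-sym (countB≡∑ _ (allFin n))) (∑-allFin-δ y (const 1)) ⟩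
    countB (λ x → adj G v x ∧ not (eqᵇ y x)) (allFin n) + 1 ∎
    where
    open ℕ.≤-Reasoning
    bound : ∀ x → ⟦ adj G v x ⟧ ≤ ⟦ adj G v x ∧ not (eqᵇ y x) ⟧ + (if eqᵇ y x then 1 else 0)
    bound x with y ≟ x
    ... | yes refl rewrite ∧-zeroʳ (adj G v y) = ⟦⟧≤1 (adj G v y)
    ... | no _ rewrite ∧-identityʳ (adj G v x) | ℕ.+-identityʳ ⟦ adj G v x ⟧ = ℕ.≤-refl

  neighbour-≢ : ∀ {v} → 2 ≤ degree v → ∀ y → ∃ λ x → Adj G v x × x ≢ y
  neighbour-≢ {v} 2≤deg y
    with countB-witness (λ x → adj G v x ∧ not (eqᵇ y x)) (allFin n)
           (ℕ.+-cancelʳ-≤ 1 1 _ (ℕ.≤-trans 2≤deg (degree-≤-avoiding v y)))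
  ... | x , _ , vx∧x≢y = x , ∧-conicalˡ _ _ vx∧x≢y , λ { refl → x≢x (∧-conicalʳ _ _ vx∧x≢y) }
    where
    x≢x : not (eqᵇ x x) ≢ true
    x≢x rewrite eqᵇ-refl x = λ ()

  2≤degree : ∀ {v x y} → Adj G v x → Adj G v y → x ≢ y → 2 ≤ degree v
  2≤degree {v} {x} {y} vx vy x≢y = begin
    2
      ≡⟨ ≡-sym (cong₂ _+_ (∑-allFin-δ x (const 1)) (∑-allFin-δ y (const 1))) ⟩
    ∑ (allFin n) (λ z → if eqᵇ x z then 1 else 0) + ∑ (allFin n) (λ z → if eqᵇ y z then 1 else 0)
      ≡⟨ ≡-sym (∑-+ _ _ (allFin n)) ⟩
    ∑ (allFin n) (λ z → (if eqᵇ x z then 1 else 0) + (if eqᵇ y z then 1 else 0))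
      ≤⟨ ∑-mono (allFin n) bound ⟩
    ∑ (allFin n) (⟦_⟧ ∘ adj G v)
      ≡⟨ ≡-sym (countB≡∑ (adj G v) (allFin n)) ⟩
    degree v ∎
    where
    open ℕ.≤-Reasoning
    bound : ∀ z → (if eqᵇ x z then 1 else 0) + (if eqᵇ y z then 1 else 0) ≤ ⟦ adj G v z ⟧
    bound z with x ≟ z | y ≟ z
    ... | yes refl | yes refl = ⊥-elim (x≢y refl)
    ... | yes refl | no _     rewrite vx = ℕ.≤-refl
    ... | no _     | yes refl rewrite vy = ℕ.≤-refl
    ... | no _     | no _     = z≤n

  -- Configurations of joining edges

  embed4 : ∀ {F : Graph 4} {p q r s} → Distinct4 p q r s →
    (Adj F #0 #1 → Adj G p q) → (Adj F #0 #2 → Adj G p r) → (Adj F #0 #3 → Adj G p s) →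
    (Adj F #1 #2 → Adj G q r) → (Adj F #1 #3 → Adj G q s) → (Adj F #2 #3 → Adj G r s) →
    Embedding F G
  embed4 {F} {p} {q} {r} {s} D pq pr ps qr qs rs = quad p q r s , quad-injective D , edges
    where
    reverse : ∀ {i j x y} → (Adj F i j → Adj G x y) → Adj F j i → Adj G y x
    reverse ij⇒xy = Adj-sym G ∘ ij⇒xy ∘ Adj-sym F
    edges : ∀ i j → Adj F i j → Adj G (quad p q r s i) (quad p q r s j)
    edges #0 #1 = pq
    edges #0 #2 = pr
    edges #0 #3 = ps
    edges #1 #2 = qr
    edges #1 #3 = qs
    edges #2 #3 = rs
    edges #1 #0 = reverse pq
    edges #2 #0 = reverse pr
    edges #3 #0 = reverse ps
    edges #2 #1 = reverse qr
    edges #3 #1 = reverse qs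
    edges #3 #2 = reverse rs
    edges #0 #0 = λ loop → ⊥-elim (Adj⇒≢ F loop refl)
    edges #1 #1 = λ loop → ⊥-elim (Adj⇒≢ F loop refl)
    edges #2 #2 = λ loop → ⊥-elim (Adj⇒≢ F loop refl)
    edges #3 #3 = λ loop → ⊥-elim (Adj⇒≢ F loop refl)

  diamondOn : ∀ {p q r s} → Distinct4 p q r s →
    Adj G p q → Adj G p r → Adj G p s → Adj G q r → Adj G q s → Embedding Diamond G
  diamondOn D pq pr ps qr qs = embed4 {F = Diamond} D (const pq) (const pr) (const ps) (const qr) (const qs) (λ ())

  cycleOn : ∀ {p q r s} → Distinct4 p q r s →
    Adj G p q → Adj G q r → Adj G r s → Adj G s p → Embedding C4 G
  cycleOn D pq qr rs sp = embed4 {F = C4} D (const pq) (λ ()) (const (Adj-sym G sp)) (const qr) (λ ()) (const rs)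

  pathOn : ∀ {p q r s} → Distinct4 p q r s → Adj G p q → Adj G q r → Adj G r s → Embedding P4 G
  pathOn D pq qr rs = embed4 {F = P4} D (const pq) (λ ()) (λ ()) (const qr) (λ ()) (const rs)

  joins≡4⇒Adj : ∀ {a b c d} → joins G a b c d ≡ 4 → Adj G a c
  joins≡4⇒Adj {a} {b} {c} {d} joins≡4 with adj G a c
  ... | true  = refl
  ... | false = ⊥-elim (ℕ.<⇒≢ (s≤s rest≤3) joins≡4)
    where
    rest≤3 : ⟦ adj G a d ⟧ + ⟦ adj G b c ⟧ + ⟦ adj G b d ⟧ ≤ 3
    rest≤3 = ℕ.+-mono-≤ (ℕ.+-mono-≤ (⟦⟧≤1 (adj G a d)) (⟦⟧≤1 (adj G b c))) (⟦⟧≤1 (adj G b d))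

  spine⇒3≤joins : ∀ {a b c d} → Adj G a c → Adj G a d → Adj G b c → 3 ≤ joins G a b c d
  spine⇒3≤joins ac ad bc rewrite ac | ad | bc = s≤s (s≤s (s≤s z≤n))

  matched⇒2≤joins : ∀ {a b c d} → Matched G a b c d → 2 ≤ joins G a b c d
  matched⇒2≤joins (inj₁ (ac , bd)) rewrite ac | bd = s≤s (ℕ.m≤n+m 1 _)
  matched⇒2≤joins {a} {c = c} (inj₂ (ad , bc)) rewrite ad | bc with adj G a c
  ... | true  = s≤s (s≤s z≤n)
  ... | false = s≤s (s≤s z≤n)

  joined⇒1≤joins : ∀ {a b c d} → Joined G a b c d → 1 ≤ joins G a b c d
  joined⇒1≤joins {a} {b} {c} {d} joined with adj G a c | adj G a d | adj G b c | adj G b d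
  ... | true  | _     | _     | _    = s≤s z≤n
  ... | false | true  | _     | _    = s≤s z≤n
  ... | false | false | true  | _    = s≤s z≤n
  ... | false | false | false | true = s≤s z≤n
  joined⇒1≤joins (inj₁ ())                   | false | false | false | false
  joined⇒1≤joins (inj₂ (inj₁ ()))            | false | false | false | false
  joined⇒1≤joins (inj₂ (inj₂ (inj₁ ())))     | false | false | false | false
  joined⇒1≤joins (inj₂ (inj₂ (inj₂ ())))     | false | false | false | false

  1≤joins⇒joined : ∀ {a b c d} → 1 ≤ joins G a b c d → Joined G a b c d
  1≤joins⇒joined {a} {b} {c} {d} 1≤joins
    with adj G a c | adj G a d | adj G b c | adj G b d
  ... | true | _    | _    | _    = inj₁ refl
  ... | _    | true | _    | _    = inj₂ (inj₁ refl)
  ... | _    | _    | true | _    = inj₂ (inj₂ (inj₁ refl))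
  ... | _    | _    | _    | true = inj₂ (inj₂ (inj₂ refl))
  1≤joins⇒joined () | false | false | false | false

  3≤joins⇒diamond : ForDisjointEdges λ a b c d → 3 ≤ joins G a b c d → Embedding Diamond G
  3≤joins⇒diamond {a} {b} {c} {d} (distinct4 a≢b a≢c a≢d b≢c b≢d c≢d) ab cd 3≤joins
    with adj G a c in ac | adj G a d in ad | adj G b c in bc | adj G b d in bd
  ... | true  | true  | true  | _     =
    diamondOn (distinct4 a≢c a≢b a≢d (≢-sym b≢c) c≢d b≢d) ac ab ad (Adj-sym G bc) cd
  ... | true  | true  | false | true  =
    diamondOn (distinct4 a≢d a≢b a≢c (≢-sym b≢d) (≢-sym c≢d) b≢c) ad ab ac (Adj-sym G bd) (Adj-sym G cd)
  ... | true  | false | true  | true  =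
    diamondOn (distinct4 b≢c (≢-sym a≢b) b≢d (≢-sym a≢c) c≢d a≢d) bc (Adj-sym G ab) bd (Adj-sym G ac) cd
  ... | false | true  | true  | true  =
    diamondOn (distinct4 b≢d (≢-sym a≢b) b≢c (≢-sym a≢d) (≢-sym c≢d) a≢c)
              bd (Adj-sym G ab) bc (Adj-sym G ad) (Adj-sym G cd)
  3≤joins⇒diamond _ _ _ (s≤s (s≤s ())) | true  | true  | false | false
  3≤joins⇒diamond _ _ _ (s≤s (s≤s ())) | true  | false | true  | false
  3≤joins⇒diamond _ _ _ (s≤s (s≤s ())) | true  | false | false | true
  3≤joins⇒diamond _ _ _ (s≤s (s≤s ())) | false | true  | true  | false
  3≤joins⇒diamond _ _ _ (s≤s (s≤s ())) | false | true  | false | true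
  3≤joins⇒diamond _ _ _ (s≤s (s≤s ())) | false | false | true  | true
  3≤joins⇒diamond _ _ _ (s≤s ())       | true  | false | false | false
  3≤joins⇒diamond _ _ _ (s≤s ())       | false | true  | false | false
  3≤joins⇒diamond _ _ _ (s≤s ())       | false | false | true  | false
  3≤joins⇒diamond _ _ _ (s≤s ())       | false | false | false | true
  3≤joins⇒diamond _ _ _ ()             | false | false | false | false

  joins-isolatedˡ : ∀ {a b c d} → adj G a c ≡ false → adj G a d ≡ false → 
    joins G a b c d ≡ ⟦ adj G b c ⟧ + ⟦ adj G b d ⟧
  joins-isolatedˡ ac ad rewrite ac | ad = refl

  Starless : Set
  Starless = ForDisjointEdges λ a b c d → ¬ Star G a b c d

  2≤joins⇒matched : Starless → ForDisjointEdges λ a b c d → 2 ≤ joins G a b c d → Matched G a b c d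
  2≤joins⇒matched starless {a} {b} {c} {d} D ab cd 2≤joins
    with adj G a c in ac | adj G a d in ad | adj G b c in bc | adj G b d in bd
  ... | true  | _     | _     | true  = inj₁ (refl , refl)
  ... | _     | true  | true  | _     = inj₂ (refl , refl)
  ... | true  | true  | false | false = ⊥-elim (starless D ab cd (ac , ad , bc , bd))
  ... | false | false | true  | true  = ⊥-elim (starless (swapˡ D) (Adj-sym G ab) cd (bc , bd , ac , ad))
  ... | true  | false | true  | false =
    ⊥-elim (starless (exchange D) cd ab (Adj-sym G ac , Adj-sym G bc , nonAdj-sym G ad , nonAdj-sym G bd))
  ... | false | true  | false | true  =
    ⊥-elim (starless (swapˡ (exchange D)) (Adj-sym G cd) ab
                     (Adj-sym G ad , Adj-sym G bd , nonAdj-sym G ac , nonAdj-sym G bc))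
  2≤joins⇒matched _ _ _ _ (s≤s ()) | true  | false | false | false
  2≤joins⇒matched _ _ _ _ (s≤s ()) | false | true  | false | false
  2≤joins⇒matched _ _ _ _ (s≤s ()) | false | false | true  | false
  2≤joins⇒matched _ _ _ _ (s≤s ()) | false | false | false | true
  2≤joins⇒matched _ _ _ _ ()       | false | false | false | false

  -- This is where regularity is used: deg b = deg a ≥ 2.
  star⇒outerNeighbour : ∀ {k a b c d} → Regular k → Distinct4 a b c d → Adj G a b → Star G a b c d →
    ∃ λ x → Adj G b x × Distinct4 b x c d × x ≢ a
  star⇒outerNeighbour {a = a} {b} regular D ab (ac , _ , bc , bd) =
    let x , bx , x≢a = neighbour-≢ 2≤deg-b a
    in x , bx , distinct4 (Adj⇒≢ G bx) b≢c b≢d (Adj-nonAdj⇒≢ G bx bc) (Adj-nonAdj⇒≢ G bx bd) c≢d , x≢a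
    where
    open Distinct4 D
    2≤deg-b : 2 ≤ degree b
    2≤deg-b = subst (2 ≤_) (trans (regular a) (≡-sym (regular b))) (2≤degree ab ac b≢c)

  C4-through : ∀ {a b c d} → Distinct4 a b c d → Adj G a b → Adj G c d → Matched G a b c d →
    Σ (Embedding C4 G) λ e → EdgeInCopy {F = C4} {G = G} e a b × EdgeInCopy {F = C4} {G = G} e c d
  C4-through D ab cd (inj₁ (ac , bd)) =
    cycleOn (swapʳ D) ab bd (Adj-sym G cd) (Adj-sym G ac) ,
    (#0 , #1 , refl , refl , refl) , (#3 , #2 , refl , refl , refl)
  C4-through D ab cd (inj₂ (ad , bc)) =
    cycleOn D ab bc cd (Adj-sym G ad) , (#0 , #1 , refl , refl , refl) , (#2 , #3 , refl , refl , refl)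

  P4-through : ∀ {a b c d} → Distinct4 a b c d → Adj G a b → Adj G c d → Joined G a b c d →
    Σ (Embedding P4 G) λ e → EdgeInCopy {F = P4} {G = G} e a b × EdgeInCopy {F = P4} {G = G} e c d
  P4-through D ab cd (inj₁ ac) =
    pathOn (swapˡ D) (Adj-sym G ab) ac cd , (#1 , #0 , refl , refl , refl) , (#2 , #3 , refl , refl , refl)
  P4-through D ab cd (inj₂ (inj₁ ad)) =
    pathOn (swapʳ (swapˡ D)) (Adj-sym G ab) ad (Adj-sym G cd) ,
    (#1 , #0 , refl , refl , refl) , (#3 , #2 , refl , refl , refl)
  P4-through D ab cd (inj₂ (inj₂ (inj₁ bc))) =
    pathOn D ab bc cd , (#0 , #1 , refl , refl , refl) , (#2 , #3 , refl , refl , refl)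
  P4-through D ab cd (inj₂ (inj₂ (inj₂ bd))) =
    pathOn (swapʳ D) ab bd (Adj-sym G cd) , (#0 , #1 , refl , refl , refl) , (#3 , #2 , refl , refl , refl)

  matched⇒NonAdjEdgesIn-C4 : ForDisjointEdges (Matched G) → NonAdjEdgesIn C4 G
  matched⇒NonAdjEdgesIn-C4 matched a b c d ab cd a≢c a≢d b≢c b≢d = C4-through D ab cd (matched D ab cd)
    where D = distinct4 (Adj⇒≢ G ab) a≢c a≢d b≢c b≢d (Adj⇒≢ G cd)

  joined⇒NonAdjEdgesIn-P4 : ForDisjointEdges (Joined G) → NonAdjEdgesIn P4 G
  joined⇒NonAdjEdgesIn-P4 joined a b c d ab cd a≢c a≢d b≢c b≢d = P4-through D ab cd (joined D ab cd)
    where D = distinct4 (Adj⇒≢ G ab) a≢c a≢d b≢c b≢d (Adj⇒≢ G cd)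

  NonAdjEdgesIn-C4⇒matched : NonAdjEdgesIn C4 G → ForDisjointEdges (Matched G)
  NonAdjEdgesIn-C4⇒matched copies {a} {b} {c} {d} (distinct4 _ a≢c a≢d b≢c b≢d _) ab cd
    with copies a b c d ab cd a≢c a≢d b≢c b≢d
  ... | e@(g , _) , (i , j , ij , refl , refl) , (k , l , kl , refl , refl) =
    Matched-image {F = C4} {G = G} e
      (C4-disjointEdges-matched i j k l ij kl (a≢c ∘ cong g) (a≢d ∘ cong g) (b≢c ∘ cong g) (b≢d ∘ cong g))

  NonAdjEdgesIn-P4⇒joined : NonAdjEdgesIn P4 G → ForDisjointEdges (Joined G)
  NonAdjEdgesIn-P4⇒joined copies {a} {b} {c} {d} (distinct4 _ a≢c a≢d b≢c b≢d _) ab cd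
    with copies a b c d ab cd a≢c a≢d b≢c b≢d
  ... | e@(g , _) , (i , j , ij , refl , refl) , (k , l , kl , refl , refl) =
    Joined-image {F = P4} {G = G} e
      (P4-disjointEdges-joined i j k l ij kl (a≢c ∘ cong g) (a≢d ∘ cong g) (b≢c ∘ cong g) (b≢d ∘ cong g))

  joinedBy⇒diamondFree : ∀ {μ} → JoinedBy μ → μ ≤ 2 → Free Diamond G
  joinedBy⇒diamondFree joined μ≤2 e@(_ , _ , edges) =
    ℕ.≤⇒≯ μ≤2 (subst (3 ≤_) (joined (image-distinct4 {F = Diamond} {G = G} e distinct-0213)
                                     (edges #0 #2 refl) (edges #1 #3 refl))
                             (spine⇒3≤joins (edges #0 #1 refl) (edges #0 #3 refl) (edges #2 #1 refl)))

  joinedBy⇒C4Free : ∀ {μ} → JoinedBy μ → μ ≤ 1 → Free C4 G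
  joinedBy⇒C4Free joined μ≤1 e@(_ , _ , edges) =
    ℕ.≤⇒≯ μ≤1 (subst (2 ≤_) (joined (image-distinct4 {F = C4} {G = G} e distinct-0123)
                                     (edges #0 #1 refl) (edges #2 #3 refl))
                             (matched⇒2≤joins (inj₂ (edges #0 #3 refl , edges #1 #2 refl))))

  diamondFree⇒joins≤2 : Free Diamond G → ForDisjointEdges λ a b c d → joins G a b c d ≤ 2
  diamondFree⇒joins≤2 free D ab cd = ℕ.≤-pred (ℕ.≰⇒> (free ∘ 3≤joins⇒diamond D ab cd))

  joinedBy2⇒starless : ∀ {k} → Regular k → JoinedBy 2 → Starless
  joinedBy2⇒starless regular joined D@(distinct4 _ a≢c a≢d _ _ c≢d) ab cd star@(ac , ad , bc , bd)
    with star⇒outerNeighbour regular D ab star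
  ... | x , bx , D′@(distinct4 _ _ _ x≢c x≢d _) , x≢a
    with ⟦⟧+⟦⟧≡2 (trans (≡-sym (joins-isolatedˡ bc bd)) (joined D′ bx cd))
  ... | xc , xd =
    joinedBy⇒diamondFree joined ℕ.≤-refl
      (diamondOn (distinct4 c≢d (≢-sym a≢c) (≢-sym x≢c) (≢-sym a≢d) (≢-sym x≢d) (≢-sym x≢a))
                 cd (Adj-sym G ac) (Adj-sym G xc) (Adj-sym G ad) (Adj-sym G xd))

  C4Free⇒starless : ∀ {k} → Regular k → Free C4 G → ForDisjointEdges (Joined G) → Starless
  C4Free⇒starless regular free joined D@(distinct4 a≢b a≢c a≢d _ _ _) ab cd star@(ac , ad , bc , bd)
    with star⇒outerNeighbour regular D ab star
  ... | x , bx , D′@(distinct4 b≢x b≢c b≢d x≢c x≢d _) , x≢a with joined D′ bx cd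
  ... | inj₁ bc′              = Adj-nonAdj⇒≢ G bc′ bc refl
  ... | inj₂ (inj₁ bd′)       = Adj-nonAdj⇒≢ G bd′ bd refl
  ... | inj₂ (inj₂ (inj₁ xc)) =
    free (cycleOn (distinct4 a≢b (≢-sym x≢a) a≢c b≢x b≢c x≢c) ab bx xc (Adj-sym G ac))
  ... | inj₂ (inj₂ (inj₂ xd)) =
    free (cycleOn (distinct4 a≢b (≢-sym x≢a) a≢d b≢x b≢d x≢d) ab bx xd (Adj-sym G ad))

  C4Free⇒joins≤1 : ∀ {k} → Regular k → Free C4 G → ForDisjointEdges (Joined G) →
    ForDisjointEdges λ a b c d → joins G a b c d ≤ 1
  C4Free⇒joins≤1 regular free joined D ab cd = ℕ.≤-pred (ℕ.≰⇒> λ 2≤joins →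
    free (proj₁ (C4-through D ab cd (2≤joins⇒matched (C4Free⇒starless regular free joined) D ab cd 2≤joins))))

  joinedBy4⇒minDegree : ∀ {k} → Regular k → JoinedBy 4 →
    ForDisjointEdges λ a b c d → ∀ v → 2 ≤ degree v
  joinedBy4⇒minDegree regular joined {a} D ab cd v =
    subst (2 ≤_) (trans (regular a) (≡-sym (regular v)))
          (2≤degree ab (joins≡4⇒Adj (joined D ab cd)) (Distinct4.b≢c D))

  joinedBy4⇒adjacent : (∀ v → 2 ≤ degree v) → JoinedBy 4 → ∀ {i j} → i ≢ j → Adj G i j
  joinedBy4⇒adjacent 2≤deg joined {i} {j} i≢j with adj G i j in ij
  ... | true  = refl
  ... | false =
    let x , ix , x≢j = neighbour-≢ (2≤deg i) j
        y , jy , y≢x = neighbour-≢ (2≤deg j) x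
        i≢y = ≢-sym (Adj-nonAdj⇒≢ G jy (nonAdj-sym G ij))
        D = distinct4 (Adj⇒≢ G ix) i≢j i≢y x≢j (≢-sym y≢x) (Adj⇒≢ G jy)
    in ⊥-elim (Adj-nonAdj⇒≢ G (joins≡4⇒Adj (joined D ix jy)) ij refl)

  adjacent⇒joinedBy4 : (∀ {i j} → i ≢ j → Adj G i j) → JoinedBy 4
  adjacent⇒joinedBy4 adjacent (distinct4 _ a≢c a≢d b≢c b≢d _) _ _
    rewrite adjacent a≢c | adjacent a≢d | adjacent b≢c | adjacent b≢d = refl

  adjacent⇒≅K : (∀ {i j} → i ≢ j → Adj G i j) → G ≅ K n
  adjacent⇒≅K adjacent = ↔-id (Fin n) , adj≡K
    where
    adj≡K : ∀ i j → adj G i j ≡ not (eqᵇ i j)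
    adj≡K i j with i ≟ j
    ... | yes refl = irrefl G i
    ... | no i≢j   = adjacent i≢j

  ≅K⇒adjacent : G ≅ K n → ∀ {i j} → i ≢ j → Adj G i j
  ≅K⇒adjacent (f , preserves) {i} {j} i≢j =
    trans (preserves i j) (cong not (eqᵇ-≢ (i≢j ∘ Injection.injective (↔⇒↣ f))))

  linePSR₄⇔complete : ∀ {k} → Regular k → LineNonComplete G →
    LinePSR G 4 ⇔ (G ≅ K n × 4 ≤ n)
  linePSR₄⇔complete regular ((a , b) , (c , d) , ab∈ , cd∈ , ab≢cd , ab≁cd) = mk⇔
    (λ line → let joined = linePSR⇒joinedBy line in
      adjacent⇒≅K (joinedBy4⇒adjacent (joinedBy4⇒minDegree regular joined D ab cd) joined) , Distinct4⇒4≤n D)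
    (λ (iso , _) → joinedBy⇒linePSR regular (adjacent⇒joinedBy4 (≅K⇒adjacent iso)))
    where
    D = lineNonAdj⇒distinct ab∈ cd∈ ab≢cd ab≁cd
    ab = proj₂ (∈-edgeList⁻ ab∈)
    cd = proj₂ (∈-edgeList⁻ cd∈)

  linePSR₂⇔diamondFree∧C4s : ∀ {k} → Regular k →
    LinePSR G 2 ⇔ (Free Diamond G × Free (K 4) G × NonAdjEdgesIn C4 G)
  linePSR₂⇔diamondFree∧C4s regular = mk⇔
    (λ line → let joined = linePSR⇒joinedBy line
                  diamondFree = joinedBy⇒diamondFree joined ℕ.≤-refl in
      diamondFree , diamondFree ∘ K4⇒Diamond {G = G} ,
      matched⇒NonAdjEdgesIn-C4 λ D ab cd →
        2≤joins⇒matched (joinedBy2⇒starless regular joined) D ab cd (ℕ.≤-reflexive (≡-sym (joined D ab cd))))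
    (λ (diamondFree , _ , cycles) → joinedBy⇒linePSR regular λ D ab cd →
      ℕ.≤-antisym (diamondFree⇒joins≤2 diamondFree D ab cd)
                  (matched⇒2≤joins (NonAdjEdgesIn-C4⇒matched cycles D ab cd)))

  linePSR₁⇔C4Free∧P4s : ∀ {k} → Regular k →
    LinePSR G 1 ⇔ (Free Diamond G × Free (K 4) G × Free C4 G × NonAdjEdgesIn P4 G)
  linePSR₁⇔C4Free∧P4s regular = mk⇔
    (λ line → let joined = linePSR⇒joinedBy line
                  diamondFree = joinedBy⇒diamondFree joined (s≤s z≤n) in
      diamondFree , diamondFree ∘ K4⇒Diamond {G = G} , joinedBy⇒C4Free joined ℕ.≤-refl ,
      joined⇒NonAdjEdgesIn-P4 λ D ab cd → 1≤joins⇒joined (ℕ.≤-reflexive (≡-sym (joined D ab cd))))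
    (λ (_ , _ , C4Free , paths) → joinedBy⇒linePSR regular λ D ab cd →
      let joined = NonAdjEdgesIn-P4⇒joined paths in
      ℕ.≤-antisym (C4Free⇒joins≤1 regular C4Free joined D ab cd) (joined⇒1≤joins (joined D ab cd)))

-- Only the regularity of G enters.
mainTheorem11 : {n k μ : ℕ} (G : Graph n) → IsPSR G k μ →
    (LineNonComplete G → (LinePSR G 4 ⇔ (G ≅ K n × 4 ≤ n)))
    × (LinePSR G 2 ⇔ (Free Diamond G × Free (K 4) G × NonAdjEdgesIn C4 G))
    × (LinePSR G 1 ⇔ (Free Diamond G × Free (K 4) G × Free C4 G × NonAdjEdgesIn P4 G))
mainTheorem11 G (degree≡k , _) =
  linePSR₄⇔complete G regular , linePSR₂⇔diamondFree∧C4s G regular , linePSR₁⇔C4Free∧P4s G regular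
  where
  regular : Regular G _
  regular v = degree≡k v (∈-allFin v)
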